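{- Let $(X,\vartriangleleft,R,Q)$ be a modal frame in which $Q\subseteq R$. Then for every $c_\vartriangleleft$-fixpoint $A$, $\Diamond_Q\neg_\vartriangleleft A\subseteq\neg_\vartriangleleft\Box_RA$.
   Context: A modal frame is a tuple $(X,\vartriangleleft,R,Q)$ with $X$ nonempty and $\vartriangleleft,R,Q$ binary relations on $X$ such that for all $x,y,z$: if $xRy$ and $z\vartriangleleft y$, then there is $x'\vartriangleleft x$ such that for all $x''$ with $x'\vartriangleleft x''$ there is $y''$ with $x''Ry''$ and $z\vartriangleleft y''$. ($u\vartriangleright v$ means $v\vartriangleleft u$.) $c_\vartriangleleft(A)=\{x\mid \forall y\vartriangleleft x\ \exists z\vartriangleright y: z\in A\}$. $\neg_\vartriangleleft A=\{x\mid \forall y\vartriangleleft x,\ y\notin A\}$; $\Box_RA=\{x\mid \forall y(xRy\Rightarrow y\in A)\}$; $\Diamond_QA=\{x\mid \forall x'\vartriangleleft x\ \exists y'\,(x'Qy')\ \exists y\vartriangleright y': y\in A\}$. -}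

module Defs where

open import Level using (Level; _⊔_; suc)
open import Data.Product using (Σ; ∃; _×_; _,_)
open import Relation.Nullary using (¬_)

Rel₀ : ∀ {a} → Set a → (ℓ : Level) → Set (a ⊔ suc ℓ)
Rel₀ X ℓ = X → X → Set ℓ

Subset : ∀ {a} → Set a → (ℓ : Level) → Set (a ⊔ suc ℓ)
Subset X ℓ = X → Set ℓ

_⊆_ : ∀ {a ℓ₁ ℓ₂} {X : Set a} → Subset X ℓ₁ → Subset X ℓ₂ → Set (a ⊔ ℓ₁ ⊔ ℓ₂)
A ⊆ B = ∀ x → A x → B x

-- Modal frame (X, ◁, R, Q); x ◁ y is written  tri x y  ("x ◁ y").
-- X is nonempty (an inhabitant is part of the data).
record ModalFrame (a ℓ : Level) : Set (suc (a ⊔ ℓ)) where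
  field
    X    : Set a
    pt   : X
    tri  : Rel₀ X ℓ
    R    : Rel₀ X ℓ
    Q    : Rel₀ X ℓ
    frame-cond : ∀ x y z → R x y → tri z y →
      Σ X λ x' → tri x' x × (∀ x'' → tri x' x'' → Σ X λ y'' → R x'' y'' × tri z y'')

module _ {a ℓ : Level} (F : ModalFrame a ℓ) where
  open ModalFrame F

  c◁ : ∀ {ℓA} → Subset X ℓA → Subset X (a ⊔ ℓ ⊔ ℓA)
  c◁ A x = ∀ y → tri y x → Σ X λ z → tri y z × A z

  neg◁ : ∀ {ℓA} → Subset X ℓA → Subset X (a ⊔ ℓ ⊔ ℓA)
  neg◁ A x = ∀ y → tri y x → ¬ A y

  boxR : ∀ {ℓA} → Subset X ℓA → Subset X (a ⊔ ℓ ⊔ ℓA)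
  boxR A x = ∀ y → R x y → A y

  diaQ : ∀ {ℓA} → Subset X ℓA → Subset X (a ⊔ ℓ ⊔ ℓA)
  diaQ A x = ∀ x' → tri x' x → Σ X λ y' → Q x' y' × Σ X λ y → tri y' y × A y

  IsFixpoint : ∀ {ℓA} → Subset X ℓA → Set (a ⊔ ℓ ⊔ ℓA)
  IsFixpoint A = (c◁ A ⊆ A) × (A ⊆ c◁ A)

{-# OPTIONS --safe #-}
module Submission where

open import Level using (Level)
open import Data.Product using (_,_)
open import Defs

module _ {a ℓ : Level} (F : ModalFrame a ℓ) where
  open ModalFrame F

  -- The Q-successor y' of y is in A since Q ⊆ R, yet lies below a point of ¬◁ A.
  diaQ-neg◁⊆neg◁-boxR : (∀ x y → Q x y → R x y) →
    ∀ {ℓA} (A : Subset X ℓA) → diaQ F (neg◁ F A) ⊆ neg◁ F (boxR F A)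
  diaQ-neg◁⊆neg◁-boxR Q⊆R A x ◇¬A y y◁x y∈□A =
    let y' , yQy' , z , y'◁z , z∈¬A = ◇¬A y y◁x
    in z∈¬A y' y'◁z (y∈□A y' (Q⊆R y y' yQy'))

proposition4p7 : {a ℓ ℓA : Level} (F : ModalFrame a ℓ) →
    (∀ x y → ModalFrame.Q F x y → ModalFrame.R F x y) →
    (A : Subset (ModalFrame.X F) ℓA) → IsFixpoint F A →
    diaQ F (neg◁ F A) ⊆ neg◁ F (boxR F A)
proposition4p7 F Q⊆R A _ = diaQ-neg◁⊆neg◁-boxR F Q⊆R A
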